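{- Let $G$ be a connected graph of order $n\geq 2$ and let $H$ be a connected graph of order $m$. Let $G*H$ be the corona of $G$ and $H$. (1) If $0\leq g\leq m-1$, then $\kappa_g(G*H)=1$. (2) Let $k$ be an integer with $1\leq k\leq \lfloor\frac{n-3}{2}\rfloor$ and let $g$ be an integer with $k(m+1)<g+1\leq (k+1)(m+1)$. Suppose $G$ has a vertex subset $X$ such that $G-X$ is not connected and every connected component of $G-X$ has at least $k+1$ vertices, and let $X$ be such a subset of minimum cardinality. Then $$\kappa_g(G*H)=|X|(m+1).$$
   Context: The corona $G*H$ is obtained by taking one copy of $G$ and $|V(G)|$ copies of $H$, and joining every vertex of the $i$-th copy of $H$ to the $i$-th vertex of $G$, for $i=1,\dots,|V(G)|$. A set $S$ of vertices is a cutset if deleting it leaves a disconnected graph; for a non-negative integer $g$, a cutset is an $R_g$-cutset if every component of the remaining graph has at least $g+1$ vertices. If a graph $F$ has an $R_g$-cutset, $\kappa_g(F)$ is the minimum cardinality of an $R_g$-cutset of $F$. -}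

module Defs where

open import Data.Nat using (ℕ; suc; _+_; _*_; _≤_)
open import Data.Bool using (Bool; true; false; _∧_)
open import Data.Fin using (Fin; splitAt; remQuot; _≟_)
open import Data.Fin.Subset using (Subset; _∈_; ∣_∣; ⊤; ∁)
open import Data.Sum using (_⊎_; inj₁; inj₂)
open import Data.Product using (Σ; ∃; _×_; _,_; proj₁; proj₂)
open import Relation.Nullary using (¬_; does)
open import Relation.Binary.PropositionalEquality using (_≡_)

Graph : ℕ → Set
Graph n = Fin n → Fin n → Bool

IsSimple : ∀ {n} → Graph n → Set
IsSimple {n} G = (∀ (u v : Fin n) → G u v ≡ G v u) × (∀ (u : Fin n) → G u u ≡ false)

data Walk {n} (G : Graph n) (S : Subset n) : Fin n → Fin n → Set where
  here : ∀ {u} → u ∈ S → Walk G S u u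
  step : ∀ {u w v} → u ∈ S → G u w ≡ true → Walk G S w v → Walk G S u v

Connected : ∀ {n} → Graph n → Set
Connected {n} G = ∀ (u v : Fin n) → Walk G ⊤ u v

IsCutset : ∀ {n} → Graph n → Subset n → Set
IsCutset {n} G S =
  Σ (Fin n) λ u → Σ (Fin n) λ v → u ∈ ∁ S × v ∈ ∁ S × ¬ Walk G (∁ S) u v

ComponentAtLeast : ∀ {n} → Graph n → Subset n → Fin n → ℕ → Set
ComponentAtLeast {n} G S u k =
  Σ (Subset n) λ C → k ≤ ∣ C ∣ × (∀ (v : Fin n) → v ∈ C → Walk G (∁ S) u v)

IsRgCutset : ∀ {n} → Graph n → ℕ → Subset n → Set
IsRgCutset {n} G g S =
  IsCutset G S × (∀ (u : Fin n) → u ∈ ∁ S → ComponentAtLeast G S u (suc g))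

IsMinRgCutset : ∀ {n} → Graph n → ℕ → Subset n → Set
IsMinRgCutset {n} G g S =
  IsRgCutset G g S × (∀ (T : Subset n) → IsRgCutset G g T → ∣ S ∣ ≤ ∣ T ∣)

-- κ_g(G) is defined and equals k: G has an R_g-cutset, and k is the minimum
-- cardinality of an R_g-cutset.
KappaEq : ∀ {n} → Graph n → ℕ → ℕ → Set
KappaEq {n} G g k = Σ (Subset n) λ S → IsMinRgCutset G g S × ∣ S ∣ ≡ k

-- Corona G * H.  Vertex set Fin (n + n * m): the first n vertices are the
-- copy of G; vertex (i , j) of Fin (n * m) (via remQuot) is vertex j of the
-- i-th copy of H.
corona : ∀ {n m} → Graph n → Graph m → Graph (n + n * m)
corona {n} {m} G H x y with splitAt n x | splitAt n y
... | inj₁ a | inj₁ b = G a b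
... | inj₁ a | inj₂ q = does (a ≟ proj₁ (remQuot {n} m q))
... | inj₂ p | inj₁ b = does (proj₁ (remQuot {n} m p) ≟ b)
... | inj₂ p | inj₂ q =
  does (proj₁ (remQuot {n} m p) ≟ proj₁ (remQuot {n} m q))
    ∧ H (proj₂ (remQuot {n} m p)) (proj₂ (remQuot {n} m q))

module Submission where

-- Every vertex of G * H hangs at a vertex of G (itself, or the base of its copy of H), and
-- projecting to that vertex maps walks of G * H to walks of G.  Deleting a vertex a of G
-- cuts off its copy of H, whose m vertices form a component of size at least g + 1 when
-- g < m, and G * H is connected, so κ_g = 1.  In the second range, g ≥ m, so an R_g-cutset
-- T cannot split off part of a copy of H: with a vertex of G it contains that vertex's whole
-- copy.  Hence T contains the blow-up of its trace P on G, P is an R_k-cutset of G (each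
-- component of G * H - T has more than k(m + 1) vertices, hence projects onto more than k
-- vertices), and ∣T∣ ≥ ∣P∣(m + 1) ≥ ∣X∣(m + 1).  Conversely the blow-up of X is an
-- R_g-cutset of exactly that size, since components of G - X blow up by the factor m + 1.

open import Defs
open import Data.Bool using (true; false; _∧_)
open import Data.Bool.Properties using (∧-conicalˡ)
open import Data.Empty using (⊥-elim)
open import Data.Fin
  using (Fin; zero; suc; _≟_; fromℕ<; splitAt; join; remQuot; combine; _↑ˡ_; _↑ʳ_)
open import Data.Fin.Properties
  using (any?; splitAt-↑ˡ; splitAt-↑ʳ; join-splitAt; remQuot-combine; combine-remQuot)
open import Data.Fin.Subset using (Subset; _∈_; _∉_; _⊆_; ∣_∣; ⊥; ∁; ⁅_⁆)
open import Data.Fin.Subset.Properties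
  using ( _∈?_; x∈∁p⇒x∉p; x∉p⇒x∈∁p; x∈p⇒x∉∁p; p⊆q⇒∣p∣≤∣q∣; ∣⊥∣≡0; ∣⊤∣≡n; ∣⁅x⁆∣≡1
        ; x∈⁅x⁆; x∈⁅y⁆⇒x≡y; x≢y⇒x∉⁅y⁆; ∈⊤; ∉⊥)
open import Data.Nat using (ℕ; zero; suc; _+_; _*_; _∸_; _/_; _≤_; _<_; z≤n; s≤s)
open import Data.Nat.Properties
  using ( ≤-trans; ≤-reflexive; ≤-pred; <⇒≤; <⇒≱; m≤n⇒m≤1+n; +-comm
        ; *-identityˡ; *-suc; *-monoˡ-≤; *-cancelʳ-<; module ≤-Reasoning)
open import Data.Product using (∃; _×_; _,_; proj₁; proj₂)
open import Data.Sum using (_⊎_; inj₁; inj₂)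
open import Data.Vec using ([]; _∷_; _++_; concat; map; replicate; lookup; tabulate)
open import Data.Vec.Properties
  using (lookup-++ˡ; lookup-++ʳ; lookup-concat; lookup-map; lookup-replicate; lookup∘tabulate
        ; []=⇒lookup; lookup⇒[]=)
open import Relation.Binary.PropositionalEquality
  using (_≡_; _≢_; refl; sym; trans; cong; cong₂; subst; subst₂)
open import Relation.Nullary using (yes; no; does)
open import Relation.Nullary.Decidable using (dec-true; _×-dec_)

open ≤-Reasoning

∈-transport : ∀ {k l} {p : Subset k} {q : Subset l} {x y} →
              lookup p x ≡ lookup q y → x ∈ p → y ∈ q
∈-transport {q = q} {y = y} eq x∈p = lookup⇒[]= y q (trans (sym eq) ([]=⇒lookup x∈p))

∈∁-transport : ∀ {k l} {p : Subset k} {q : Subset l} {x y} →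
               lookup p x ≡ lookup q y → x ∈ ∁ p → y ∈ ∁ q
∈∁-transport eq x∈∁p = x∉p⇒x∈∁p (λ y∈q → x∈∁p⇒x∉p x∈∁p (∈-transport (sym eq) y∈q))

∣++∣ : ∀ {k l} (p : Subset k) (q : Subset l) → ∣ p ++ q ∣ ≡ ∣ p ∣ + ∣ q ∣
∣++∣ []            q = refl
∣++∣ (true ∷ p)    q = cong suc (∣++∣ p q)
∣++∣ (false ∷ p)   q = ∣++∣ p q

blocks : ∀ {k} m → Subset k → Subset (k * m)
blocks m p = concat (map (replicate m) p)

lookup-blocks : ∀ {k} m (p : Subset k) a j → lookup (blocks m p) (combine a j) ≡ lookup p a
lookup-blocks m p a j =
  trans (lookup-concat (map (replicate m) p) a j)
        (trans (cong (λ v → lookup v j) (lookup-map a (replicate m) p))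
               (lookup-replicate j (lookup p a)))

∣blocks∣ : ∀ {k} m (p : Subset k) → ∣ blocks m p ∣ ≡ ∣ p ∣ * m
∣blocks∣ m []          = refl
∣blocks∣ m (true ∷ p)  = trans (∣++∣ (replicate m true) _) (cong₂ _+_ (∣⊤∣≡n m) (∣blocks∣ m p))
∣blocks∣ m (false ∷ p) = trans (∣++∣ (replicate m false) _) (cong₂ _+_ (∣⊥∣≡0 m) (∣blocks∣ m p))

∈⇒1≤∣∣ : ∀ {k} {p : Subset k} {x} → x ∈ p → 1 ≤ ∣ p ∣
∈⇒1≤∣∣ {x = x} x∈p =
  ≤-trans (≤-reflexive (sym (∣⁅x⁆∣≡1 x)))
          (p⊆q⇒∣p∣≤∣q∣ (λ y∈⁅x⁆ → subst (_∈ _) (sym (x∈⁅y⁆⇒x≡y x y∈⁅x⁆)) x∈p))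

image : ∀ {k l} → (Fin k → Fin l) → Subset k → Subset l
image f p = tabulate (λ b → does (any? (λ x → (x ∈? p) ×-dec (f x ≟ b))))

∈image⁺ : ∀ {k l} (f : Fin k → Fin l) {p x} → x ∈ p → f x ∈ image f p
∈image⁺ f {p} {x} x∈p =
  lookup⇒[]= (f x) (image f p)
    (trans (lookup∘tabulate _ (f x)) (dec-true (any? _) (x , x∈p , refl)))

∈image⁻ : ∀ {k l} (f : Fin k → Fin l) {p b} → b ∈ image f p → ∃ λ x → x ∈ p × f x ≡ b
∈image⁻ f {p} {b} b∈img
  with any? (λ x → (x ∈? p) ×-dec (f x ≟ b))
     | trans (sym (lookup∘tabulate (λ b → does (any? (λ x → (x ∈? p) ×-dec (f x ≟ b)))) b))
             ([]=⇒lookup b∈img)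
... | yes witness | _  = witness
... | no _        | ()

preimage : ∀ {k l} → (Fin k → Fin l) → Subset l → Subset k
preimage f q = tabulate (λ x → lookup q (f x))

lookup-preimage : ∀ {k l} (f : Fin k → Fin l) q x → lookup (preimage f q) x ≡ lookup q (f x)
lookup-preimage f q = lookup∘tabulate (λ x → lookup q (f x))

does-≟⇒≡ : ∀ {k} {a b : Fin k} → does (a ≟ b) ≡ true → a ≡ b
does-≟⇒≡ {a = a} {b} eq with a ≟ b
... | yes a≡b = a≡b
does-≟⇒≡ () | no _

≟-refl : ∀ {k} (a : Fin k) → does (a ≟ a) ≡ true
≟-refl a = dec-true (a ≟ a) refl

module _ {k : ℕ} {F : Graph k} {A : Subset k} where

  walk-source : ∀ {u v} → Walk F A u v → u ∈ A
  walk-source (here u∈A)     = u∈A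
  walk-source (step u∈A _ _) = u∈A

  walk-target : ∀ {u v} → Walk F A u v → v ∈ A
  walk-target (here v∈A)   = v∈A
  walk-target (step _ _ w) = walk-target w

  walk-++ : ∀ {u w v} → Walk F A u w → Walk F A w v → Walk F A u v
  walk-++ (here _)       w′ = w′
  walk-++ (step u∈A e w) w′ = step u∈A e (walk-++ w w′)

  walk-preserves : (P : Fin k → Set) → (∀ {x y} → P x → y ∈ A → F x y ≡ true → P y) →
                   ∀ {u v} → Walk F A u v → P u → P v
  walk-preserves P closed (here _)     Pu = Pu
  walk-preserves P closed (step _ e w) Pu = walk-preserves P closed w (closed Pu (walk-source w) e)

walk-map : ∀ {k l} {F : Graph k} {F′ : Graph l} {A : Subset k} {B : Subset l}
           (f : Fin k → Fin l) → (∀ {x} → x ∈ A → f x ∈ B) →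
           (∀ {x y} → F x y ≡ true → f x ≡ f y ⊎ F′ (f x) (f y) ≡ true) →
           ∀ {u v} → Walk F A u v → Walk F′ B (f u) (f v)
walk-map f f∈ f-adj (here u∈A) = here (f∈ u∈A)
walk-map {F′ = F′} {B = B} f f∈ f-adj {v = v} (step u∈A e w) with f-adj e
... | inj₁ fu≡fw = subst (λ z → Walk F′ B z (f v)) (sym fu≡fw) (walk-map f f∈ f-adj w)
... | inj₂ e′    = step (f∈ u∈A) e′ (walk-map f f∈ f-adj w)

walk-mono : ∀ {k} {F : Graph k} {A B : Subset k} → A ⊆ B → ∀ {u v} → Walk F A u v → Walk F B u v
walk-mono A⊆B = walk-map (λ x → x) A⊆B inj₂

connected⇒cutset-nonempty : ∀ {k} {F : Graph k} {T : Subset k} →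
                            Connected F → IsCutset F T → 1 ≤ ∣ T ∣
connected⇒cutset-nonempty {T = T} conn (u , v , _ , _ , ¬walk) with any? (_∈? T)
... | yes (x , x∈T) = ∈⇒1≤∣∣ x∈T
... | no ∄x∈T       =
  ⊥-elim (¬walk (walk-mono (λ {x} _ → x∉p⇒x∈∁p (λ x∈T → ∄x∈T (x , x∈T))) (conn u v)))

ComponentAtLeast-mono : ∀ {k} {F : Graph k} {S u i j} →
                        i ≤ j → ComponentAtLeast F S u j → ComponentAtLeast F S u i
ComponentAtLeast-mono i≤j (C , j≤∣C∣ , reach) = C , ≤-trans i≤j j≤∣C∣ , reach

module Corona {n m : ℕ} (G : Graph n) (H : Graph m) where

  N : ℕ
  N = n + n * m

  -- ι a is the vertex a of G, η a j the vertex j of the copy of H attached to a, and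
  -- π sends every vertex to the vertex of G it is attached to.
  ι : Fin n → Fin N
  ι a = a ↑ˡ (n * m)

  η : Fin n → Fin m → Fin N
  η a j = n ↑ʳ combine a j

  data View : Fin N → Set where
    gv : (a : Fin n) → View (ι a)
    hv : (a : Fin n) (j : Fin m) → View (η a j)

  view : (x : Fin N) → View x
  view x = subst View (join-splitAt n (n * m) x) (view-split (splitAt n x))
    where
    view-split : (s : Fin n ⊎ Fin (n * m)) → View (join n (n * m) s)
    view-split (inj₁ a) = gv a
    view-split (inj₂ q) = subst (λ q → View (n ↑ʳ q)) (combine-remQuot {n} m q)
                            (hv (proj₁ (remQuot {n} m q)) (proj₂ (remQuot {n} m q)))

  π : Fin N → Fin n
  π x with splitAt n x
  ... | inj₁ a = a
  ... | inj₂ q = proj₁ (remQuot {n} m q)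

  π-ι : ∀ a → π (ι a) ≡ a
  π-ι a rewrite splitAt-↑ˡ n a (n * m) = refl

  π-η : ∀ a j → π (η a j) ≡ a
  π-η a j rewrite splitAt-↑ʳ n (n * m) (combine a j) = cong proj₁ (remQuot-combine a j)

  ι≢η : ∀ a b j → ι a ≢ η b j
  ι≢η a b j ιa≡ηbj
    with trans (sym (splitAt-↑ˡ n a (n * m)))
               (trans (cong (splitAt n) ιa≡ηbj) (splitAt-↑ʳ n (n * m) (combine b j)))
  ... | ()

  adj-ιι : ∀ a b → corona G H (ι a) (ι b) ≡ G a b
  adj-ιι a b rewrite splitAt-↑ˡ n a (n * m) | splitAt-↑ˡ n b (n * m) = refl

  adj-ιη : ∀ a b j → corona G H (ι a) (η b j) ≡ does (a ≟ b)
  adj-ιη a b j rewrite splitAt-↑ˡ n a (n * m) | splitAt-↑ʳ n (n * m) (combine b j) =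
    cong (λ z → does (a ≟ proj₁ z)) (remQuot-combine b j)

  adj-ηι : ∀ a j b → corona G H (η a j) (ι b) ≡ does (a ≟ b)
  adj-ηι a j b rewrite splitAt-↑ʳ n (n * m) (combine a j) | splitAt-↑ˡ n b (n * m) =
    cong (λ z → does (proj₁ z ≟ b)) (remQuot-combine a j)

  adj-ηη : ∀ a j b j′ → corona G H (η a j) (η b j′) ≡ (does (a ≟ b) ∧ H j j′)
  adj-ηη a j b j′ rewrite splitAt-↑ʳ n (n * m) (combine a j) | splitAt-↑ʳ n (n * m) (combine b j′) =
    cong₂ (λ z w → does (proj₁ z ≟ proj₁ w) ∧ H (proj₂ z) (proj₂ w))
          (remQuot-combine a j) (remQuot-combine b j′)

  ι-adj-η : ∀ a j → corona G H (ι a) (η a j) ≡ true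
  ι-adj-η a j = trans (adj-ιη a a j) (≟-refl a)

  η-adj-ι : ∀ a j → corona G H (η a j) (ι a) ≡ true
  η-adj-ι a j = trans (adj-ηι a j a) (≟-refl a)

  π-adj : ∀ {x y} → corona G H x y ≡ true → π x ≡ π y ⊎ G (π x) (π y) ≡ true
  π-adj {x} {y} e with view x | view y
  ... | gv a   | gv b    rewrite π-ι a   | π-ι b    = inj₂ (trans (sym (adj-ιι a b)) e)
  ... | gv a   | hv b j  rewrite π-ι a   | π-η b j  = inj₁ (does-≟⇒≡ (trans (sym (adj-ιη a b j)) e))
  ... | hv a j | gv b    rewrite π-η a j | π-ι b    = inj₁ (does-≟⇒≡ (trans (sym (adj-ηι a j b)) e))
  ... | hv a j | hv b j′ rewrite π-η a j | π-η b j′ =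
    inj₁ (does-≟⇒≡ (∧-conicalˡ _ _ (trans (sym (adj-ηη a j b j′)) e)))

  π-walk : ∀ {A : Subset N} {B : Subset n} → (∀ {x} → x ∈ A → π x ∈ B) →
           ∀ {u v} → Walk (corona G H) A u v → Walk G B (π u) (π v)
  π-walk π∈ = walk-map π π∈ π-adj

  ι-walk : ∀ {A : Subset N} {B : Subset n} → (∀ {a} → a ∈ B → ι a ∈ A) →
           ∀ {a b} → Walk G B a b → Walk (corona G H) A (ι a) (ι b)
  ι-walk ι∈ = walk-map ι ι∈ (λ {a} {b} e → inj₂ (trans (adj-ιι a b) e))

  walk-to-base : ∀ {A : Subset N} {u} → u ∈ A → ι (π u) ∈ A → Walk (corona G H) A u (ι (π u))
  walk-to-base {u = u} u∈A ιπu∈A with view u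
  ... | gv a   rewrite π-ι a   = here u∈A
  ... | hv a j rewrite π-η a j = step u∈A (η-adj-ι a j) (here ιπu∈A)

  walk-from-base : ∀ {A : Subset N} {u} → u ∈ A → ι (π u) ∈ A → Walk (corona G H) A (ι (π u)) u
  walk-from-base {u = u} u∈A ιπu∈A with view u
  ... | gv a   rewrite π-ι a   = here u∈A
  ... | hv a j rewrite π-η a j = step ιπu∈A (ι-adj-η a j) (here u∈A)

  lift-walk : ∀ {A : Subset N} {B : Subset n} → (∀ {a} → a ∈ B → ι a ∈ A) →
              ∀ {u v} → u ∈ A → v ∈ A → Walk G B (π u) (π v) → Walk (corona G H) A u v
  lift-walk ι∈ u∈A v∈A w =
    walk-++ (walk-to-base u∈A (ι∈ (walk-source w)))
            (walk-++ (ι-walk ι∈ w) (walk-from-base v∈A (ι∈ (walk-target w))))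

  -- The only edges leaving the copy of H at a go to ι a.
  walk-within-copy : ∀ {A : Subset N} a → ι a ∉ A →
                     ∀ {j v} → Walk (corona G H) A (η a j) v → ∃ λ j′ → v ≡ η a j′
  walk-within-copy {A} a ιa∉A w = walk-preserves (λ x → ∃ λ j′ → x ≡ η a j′) closed w (_ , refl)
    where
    closed : ∀ {x y} → (∃ λ j′ → x ≡ η a j′) → y ∈ A → corona G H x y ≡ true → ∃ λ j′ → y ≡ η a j′
    closed {y = y} (j , refl) y∈A e with view y
    ... | gv b with does-≟⇒≡ {a = a} {b} (trans (sym (adj-ηι a j b)) e)
    ...   | refl = ⊥-elim (ιa∉A y∈A)
    closed (j , refl) y∈A e | hv b j′
      with does-≟⇒≡ {a = a} {b} (∧-conicalˡ _ _ (trans (sym (adj-ηη a j b j′)) e))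
    ... | refl = j′ , refl

  η-walk : Connected H → ∀ {A : Subset N} a → (∀ j → η a j ∈ A) →
           ∀ j j′ → Walk (corona G H) A (η a j) (η a j′)
  η-walk Hc a η∈ j j′ =
    walk-map (η a) (λ {j} _ → η∈ j)
             (λ {j} {j′} e → inj₂ (trans (adj-ηη a j a j′) (trans (cong (_∧ H j j′) (≟-refl a)) e)))
             (Hc j j′)

  ⇑ : Subset n → Subset N
  ⇑ X = X ++ blocks m X

  lookup-⇑ : ∀ X x → lookup (⇑ X) x ≡ lookup X (π x)
  lookup-⇑ X x with view x
  ... | gv a   = trans (lookup-++ˡ X (blocks m X) a) (cong (lookup X) (sym (π-ι a)))
  ... | hv a j = trans (lookup-++ʳ X (blocks m X) (combine a j))
                       (trans (lookup-blocks m X a j) (cong (lookup X) (sym (π-η a j))))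

  ∈⇑⁺ : ∀ {X x} → π x ∈ X → x ∈ ⇑ X
  ∈⇑⁺ {X} {x} = ∈-transport (sym (lookup-⇑ X x))

  ∈⇑⁻ : ∀ {X x} → x ∈ ⇑ X → π x ∈ X
  ∈⇑⁻ {X} {x} = ∈-transport (lookup-⇑ X x)

  ∈∁⇑⁺ : ∀ {X x} → π x ∈ ∁ X → x ∈ ∁ (⇑ X)
  ∈∁⇑⁺ {X} {x} = ∈∁-transport (sym (lookup-⇑ X x))

  ∈∁⇑⁻ : ∀ {X x} → x ∈ ∁ (⇑ X) → π x ∈ ∁ X
  ∈∁⇑⁻ {X} {x} = ∈∁-transport (lookup-⇑ X x)

  ∣⇑∣ : ∀ X → ∣ ⇑ X ∣ ≡ ∣ X ∣ * suc m
  ∣⇑∣ X = trans (∣++∣ X (blocks m X)) (trans (cong (∣ X ∣ +_) (∣blocks∣ m X)) (sym (*-suc ∣ X ∣ m)))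

  ⊆⇑image : ∀ C → C ⊆ ⇑ (image π C)
  ⊆⇑image C x∈C = ∈⇑⁺ (∈image⁺ π x∈C)

  copy : Fin n → Subset N
  copy a = ⊥ {n} ++ blocks m ⁅ a ⁆

  lookup-copy-η : ∀ a c j → lookup (copy a) (η c j) ≡ lookup ⁅ a ⁆ c
  lookup-copy-η a c j =
    trans (lookup-++ʳ (⊥ {n}) (blocks m ⁅ a ⁆) (combine c j)) (lookup-blocks m ⁅ a ⁆ c j)

  η∈copy : ∀ a j → η a j ∈ copy a
  η∈copy a j = ∈-transport (sym (lookup-copy-η a a j)) (x∈⁅x⁆ a)

  ∈copy⁻ : ∀ {a x} → x ∈ copy a → ∃ λ j → x ≡ η a j
  ∈copy⁻ {a} {x} x∈copy with view x
  ... | gv c = ⊥-elim (∉⊥ (∈-transport {q = ⊥ {n}} (lookup-++ˡ (⊥ {n}) (blocks m ⁅ a ⁆) c) x∈copy))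
  ... | hv c j with x∈⁅y⁆⇒x≡y a (∈-transport (lookup-copy-η a c j) x∈copy)
  ...   | refl = j , refl

  ∣copy∣ : ∀ a → ∣ copy a ∣ ≡ m
  ∣copy∣ a = trans (∣++∣ (⊥ {n}) (blocks m ⁅ a ⁆))
                   (trans (cong₂ _+_ (∣⊥∣≡0 n) (∣blocks∣ m ⁅ a ⁆))
                          (trans (cong (_* m) (∣⁅x⁆∣≡1 a)) (*-identityˡ m)))

  corona-connected : Connected G → Connected (corona G H)
  corona-connected Gc u v = lift-walk (λ _ → ∈⊤) ∈⊤ ∈⊤ (Gc (π u) (π v))

  ⇑-component : ∀ {S : Subset N} {X : Subset n} → (∀ {x} → π x ∈ ∁ X → x ∈ ∁ S) →
                ∀ {u k} → u ∈ ∁ S → ComponentAtLeast G X (π u) k →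
                ComponentAtLeast (corona G H) S u (k * suc m)
  ⇑-component {S} {X} π∈ {u} {k} u∉S (D , k≤∣D∣ , reach) =
    ⇑ D , ≤-trans (*-monoˡ-≤ (suc m) k≤∣D∣) (≤-reflexive (sym (∣⇑∣ D))) , reach⇑
    where
    ι∈ : ∀ {a} → a ∈ ∁ X → ι a ∈ ∁ S
    ι∈ {a} a∉X = π∈ (subst (_∈ ∁ X) (sym (π-ι a)) a∉X)
    reach⇑ : ∀ v → v ∈ ⇑ D → Walk (corona G H) (∁ S) u v
    reach⇑ v v∈⇑D = lift-walk ι∈ u∉S (π∈ (walk-target w)) w
      where
      w = reach (π v) (∈⇑⁻ v∈⇑D)

  ⇑-cutset : ∀ {X} → IsCutset G X → IsCutset (corona G H) (⇑ X)
  ⇑-cutset {X} (a , b , a∉X , b∉X , ¬walk) =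
    ι a , ι b , ι∈ a∉X , ι∈ b∉X ,
    λ w → ¬walk (subst₂ (Walk G (∁ X)) (π-ι a) (π-ι b) (π-walk ∈∁⇑⁻ w))
    where
    ι∈ : ∀ {a} → a ∈ ∁ X → ι a ∈ ∁ (⇑ X)
    ι∈ {a} a∉X = ∈∁⇑⁺ (subst (_∈ ∁ X) (sym (π-ι a)) a∉X)

  ⇑-RgCutset : ∀ {X k g} → IsRgCutset G k X → suc g ≤ suc k * suc m →
               IsRgCutset (corona G H) g (⇑ X)
  ⇑-RgCutset {X} (cut , comp) g<size =
    ⇑-cutset cut ,
    λ u u∉⇑X → ComponentAtLeast-mono g<size (⇑-component ∈∁⇑⁺ u∉⇑X (comp (π u) (∈∁⇑⁻ u∉⇑X)))

  trace : Subset N → Subset n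
  trace = preimage ι

  module _ {g : ℕ} (m≤g : m ≤ g) {T : Subset N} (T-Rg : IsRgCutset (corona G H) g T) where

    -- Otherwise the component of η a j in G * H - T would lie inside the copy of H at a.
    copy⊆ : ∀ {a} j → ι a ∈ T → η a j ∈ T
    copy⊆ {a} j ιa∈T with η a j ∈? T
    ... | yes ηaj∈T = ηaj∈T
    ... | no ηaj∉T with proj₂ T-Rg (η a j) (x∉p⇒x∈∁p ηaj∉T)
    ...   | C , g<∣C∣ , reach = ⊥-elim (<⇒≱ (s≤s m≤g) (begin
      suc g        ≤⟨ g<∣C∣ ⟩
      ∣ C ∣        ≤⟨ p⊆q⇒∣p∣≤∣q∣ C⊆copy ⟩
      ∣ copy a ∣   ≡⟨ ∣copy∣ a ⟩
      m            ∎))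
      where
      C⊆copy : C ⊆ copy a
      C⊆copy {v} v∈C with walk-within-copy a (x∈p⇒x∉∁p ιa∈T) (reach v v∈C)
      ... | j′ , refl = η∈copy a j′

    ⇑trace⊆ : ⇑ (trace T) ⊆ T
    ⇑trace⊆ {x} x∈⇑ with view x | ∈-transport (lookup-preimage ι T (π x)) (∈⇑⁻ {trace T} x∈⇑)
    ... | gv a   | ιπx∈T = subst (_∈ T) (cong ι (π-ι a)) ιπx∈T
    ... | hv a j | ιπx∈T = copy⊆ j (subst (_∈ T) (cong ι (π-η a j)) ιπx∈T)

    π∈∁trace : ∀ {x} → x ∈ ∁ T → π x ∈ ∁ (trace T)
    π∈∁trace x∉T = x∉p⇒x∈∁p (λ πx∈trace → x∈∁p⇒x∉p x∉T (⇑trace⊆ (∈⇑⁺ πx∈trace)))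

    ι∈∁ : ∀ {a} → a ∈ ∁ (trace T) → ι a ∈ ∁ T
    ι∈∁ {a} = ∈∁-transport (lookup-preimage ι T a)

    trace-cutset : IsCutset G (trace T)
    trace-cutset with proj₁ T-Rg
    ... | u , v , u∉T , v∉T , ¬walk =
      π u , π v , π∈∁trace u∉T , π∈∁trace v∉T , λ w → ¬walk (lift-walk ι∈∁ u∉T v∉T w)

    -- A component with more than k (m + 1) vertices meets more than k fibres of π.
    trace-component : ∀ {k} → k * suc m < suc g →
                      ∀ a → a ∈ ∁ (trace T) → ComponentAtLeast G (trace T) a (suc k)
    trace-component {k} size a a∉trace with proj₂ T-Rg (ι a) (ι∈∁ a∉trace)
    ... | C , g<∣C∣ , reach = image π C , k<∣D∣ , reachD
      where
      k<∣D∣ : k < ∣ image π C ∣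
      k<∣D∣ = *-cancelʳ-< (suc m) k ∣ image π C ∣ (begin-strict
        k * suc m               <⟨ size ⟩
        suc g                   ≤⟨ g<∣C∣ ⟩
        ∣ C ∣                   ≤⟨ p⊆q⇒∣p∣≤∣q∣ (⊆⇑image C) ⟩
        ∣ ⇑ (image π C) ∣       ≡⟨ ∣⇑∣ (image π C) ⟩
        ∣ image π C ∣ * suc m   ∎)
      reachD : ∀ b → b ∈ image π C → Walk G (∁ (trace T)) a b
      reachD b b∈D with ∈image⁻ π b∈D
      ... | x , x∈C , refl =
        subst (λ z → Walk G (∁ (trace T)) z (π x)) (π-ι a) (π-walk π∈∁trace (reach x x∈C))

    trace-RgCutset : ∀ {k} → k * suc m < suc g → IsRgCutset G k (trace T)
    trace-RgCutset size = trace-cutset , trace-component size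

    ∣trace∣-bound : ∣ trace T ∣ * suc m ≤ ∣ T ∣
    ∣trace∣-bound = ≤-trans (≤-reflexive (sym (∣⇑∣ (trace T)))) (p⊆q⇒∣p∣≤∣q∣ ⇑trace⊆)

  module _ (Hc : Connected H) {a b : Fin n} (a≢b : a ≢ b) {g : ℕ} (g<m : g < m) where

    ∈∁⁅ιa⁆ : ∀ {x} → x ≢ ι a → x ∈ ∁ ⁅ ι a ⁆
    ∈∁⁅ιa⁆ x≢ιa = x∉p⇒x∈∁p (x≢y⇒x∉⁅y⁆ x≢ιa)

    vertex-cutset : IsCutset (corona G H) ⁅ ι a ⁆
    vertex-cutset =
      η a (fromℕ< g<m) , ι b ,
      ∈∁⁅ιa⁆ (λ ηa≡ιa → ι≢η a a _ (sym ηa≡ιa)) ,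
      ∈∁⁅ιa⁆ (λ ιb≡ιa → a≢b (trans (sym (π-ι a)) (trans (cong π (sym ιb≡ιa)) (π-ι b)))) ,
      λ w → let (j , ιb≡ηaj) = walk-within-copy a (x∈p⇒x∉∁p (x∈⁅x⁆ (ι a))) w in ι≢η b a j ιb≡ηaj

    vertex-component : ∀ u → u ∈ ∁ ⁅ ι a ⁆ → ComponentAtLeast (corona G H) ⁅ ι a ⁆ u (suc g)
    vertex-component u u∉⁅ιa⁆ with π u ≟ a | view u
    ... | no πu≢a | _ =
      ComponentAtLeast-mono (≤-trans (m≤n⇒m≤1+n g<m) (≤-reflexive (sym (*-identityˡ (suc m)))))
        (⇑-component π∈ u∉⁅ιa⁆ (⁅ π u ⁆ , ≤-reflexive (sym (∣⁅x⁆∣≡1 (π u))) , reach))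
      where
      π∈ : ∀ {x} → π x ∈ ∁ ⁅ a ⁆ → x ∈ ∁ ⁅ ι a ⁆
      π∈ πx∉⁅a⁆ = ∈∁⁅ιa⁆ (λ { refl → x∈∁p⇒x∉p πx∉⁅a⁆ (subst (_∈ ⁅ a ⁆) (sym (π-ι a)) (x∈⁅x⁆ a)) })
      reach : ∀ c → c ∈ ⁅ π u ⁆ → Walk G (∁ ⁅ a ⁆) (π u) c
      reach c c∈ rewrite x∈⁅y⁆⇒x≡y (π u) c∈ = here (x∉p⇒x∈∁p (x≢y⇒x∉⁅y⁆ πu≢a))
    ... | yes πu≡a | hv c j with trans (sym (π-η c j)) πu≡a
    ...   | refl = copy a , ≤-trans g<m (≤-reflexive (sym (∣copy∣ a))) , reach
      where
      η∈ : ∀ j → η a j ∈ ∁ ⁅ ι a ⁆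
      η∈ j = ∈∁⁅ιa⁆ (λ ηaj≡ιa → ι≢η a a j (sym ηaj≡ιa))
      reach : ∀ v → v ∈ copy a → Walk (corona G H) (∁ ⁅ ι a ⁆) (η a j) v
      reach v v∈copy with ∈copy⁻ {a} v∈copy
      ... | j′ , refl = η-walk Hc a η∈ j j′
    vertex-component u u∉⁅ιa⁆ | yes πu≡a | gv c with trans (sym (π-ι c)) πu≡a
    ... | refl = ⊥-elim (x∈∁p⇒x∉p u∉⁅ιa⁆ (x∈⁅x⁆ (ι a)))

    vertex-RgCutset : IsRgCutset (corona G H) g ⁅ ι a ⁆
    vertex-RgCutset = vertex-cutset , vertex-component

  κ-vertex : Connected G → Connected H → ∀ {a b : Fin n} → a ≢ b →
             ∀ {g} → g < m → KappaEq (corona G H) g 1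
  κ-vertex Gc Hc {a} a≢b g<m =
    ⁅ ι a ⁆ ,
    (vertex-RgCutset Hc a≢b g<m ,
     λ T T-Rg → ≤-trans (≤-reflexive (∣⁅x⁆∣≡1 (ι a)))
                        (connected⇒cutset-nonempty (corona-connected Gc) (proj₁ T-Rg))) ,
    ∣⁅x⁆∣≡1 (ι a)

  κ-⇑ : ∀ {k g X} → 1 ≤ k → k * suc m < suc g → suc g ≤ suc k * suc m →
        IsMinRgCutset G k X → KappaEq (corona G H) g (∣ X ∣ * suc m)
  κ-⇑ {k} {g} {X} 1≤k lower upper (X-Rg , X-min) = ⇑ X , (⇑-RgCutset X-Rg upper , minimal) , ∣⇑∣ X
    where
    m<k*[1+m] : m < k * suc m
    m<k*[1+m] = ≤-trans (≤-reflexive (sym (*-identityˡ (suc m)))) (*-monoˡ-≤ (suc m) 1≤k)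
    m≤g : m ≤ g
    m≤g = ≤-pred (≤-trans (s≤s (<⇒≤ m<k*[1+m])) lower)
    minimal : ∀ T → IsRgCutset (corona G H) g T → ∣ ⇑ X ∣ ≤ ∣ T ∣
    minimal T T-Rg = begin
      ∣ ⇑ X ∣               ≡⟨ ∣⇑∣ X ⟩
      ∣ X ∣ * suc m         ≤⟨ *-monoˡ-≤ (suc m) (X-min (trace T) (trace-RgCutset m≤g T-Rg lower)) ⟩
      ∣ trace T ∣ * suc m   ≤⟨ ∣trace∣-bound m≤g T-Rg ⟩
      ∣ T ∣                 ∎

theorem2p2 : ∀ (n m : ℕ) (G : Graph n) (H : Graph m) →
    IsSimple G → IsSimple H → Connected G → Connected H → 2 ≤ n →
    (∀ (g : ℕ) → g < m → KappaEq (corona G H) g 1)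
    × (∀ (k g : ℕ) (X : Subset n) → 1 ≤ k → k ≤ (n ∸ 3) / 2 →
        k * (m + 1) < g + 1 → g + 1 ≤ (k + 1) * (m + 1) →
        IsMinRgCutset G k X →
        KappaEq (corona G H) g (∣ X ∣ * (m + 1)))
theorem2p2 (suc (suc n′)) m G H _ _ Gc Hc (s≤s (s≤s z≤n)) =
  (λ g g<m → κ-vertex Gc Hc {zero} {suc zero} (λ ()) g<m) ,
  (λ k g X 1≤k _ → κ-⇑-shifted k g X 1≤k)
  where
  open Corona G H
  κ-⇑-shifted : ∀ k g X → 1 ≤ k → k * (m + 1) < g + 1 → g + 1 ≤ (k + 1) * (m + 1) →
                IsMinRgCutset G k X → KappaEq (corona G H) g (∣ X ∣ * (m + 1))
  κ-⇑-shifted k g X rewrite +-comm m 1 | +-comm g 1 | +-comm k 1 = κ-⇑
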